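{- Let $N\ge0$ and let $\mathcal S\subseteq\Omega_N\cup\{V\}$ with $U_N\in\mathcal S$. Let $n\ge1$. If $V\in\mathcal S$, then the total number of occurrences of the step $V$ over all paths in $\mathcal P_{\mathcal S}(1,n)$ equals $|\mathcal F_{\mathcal S}(0,n)|$. For every $k$ with $S_k\in\mathcal S$, the total number of occurrences of the step $S_k$ over all paths in $\mathcal P_{\mathcal S}(1,n)$ equals $|\mathcal F_{\mathcal S}(1+k,n-1)|$.
   Context: Steps: $V=(0,-1)$ and $S_k=(1,k)$ for $k\in\mathbb Z$; $U_k=S_k$ for $k\ge0$. $\Omega_N=\{S_k:k\le N\}$. For a set of steps $\mathcal S$, an $\mathcal S$-path is a finite sequence of steps from $\mathcal S$ starting at $(0,0)$. $\mathcal F_{\mathcal S}(m,n)$ is the set of $\mathcal S$-paths ending at $(n,-m)$; $\mathcal P_{\mathcal S}(m,n)$ is the subset of those all of whose points except possibly the last lie on or above the $x$-axis. -}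

module Defs where

open import Data.Nat using (ℕ; zero; suc)
open import Data.Integer using (ℤ; +_; -_; _+_; _≤_; 0ℤ)
open import Data.Bool using (Bool; T)
open import Data.List using (List; []; _∷_; length; lookup)
open import Data.List.Relation.Unary.All using (All)
open import Data.Fin using (Fin)
open import Data.Product using (Σ; ∃; _×_)
open import Data.Unit using (⊤)
open import Function.Bundles using (_↔_)
open import Relation.Binary.PropositionalEquality using (_≡_)

-- Steps: V = (0,-1) and S k = (1,k), k ∈ ℤ.
data Step : Set where
  V : Step
  S : ℤ → Step

StepSet : Set
StepSet = Step → Bool

dx : Step → ℕ
dx V     = 0
dx (S _) = 1

dy : Step → ℤ
dy V     = - (+ 1)
dy (S k) = k

xEnd : List Step → ℕ
xEnd []       = 0
xEnd (s ∷ p) = dx s Data.Nat.+ xEnd p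

yEnd : List Step → ℤ
yEnd []       = 0ℤ
yEnd (s ∷ p) = dy s + yEnd p

Above : ℤ → List Step → Set
Above h []       = ⊤
Above h (s ∷ p) = (0ℤ ≤ h) × Above (h + dy s) p

IsPath : StepSet → List Step → Set
IsPath 𝒮 p = All (λ s → T (𝒮 s)) p

F : StepSet → ℤ → ℕ → Set
F 𝒮 m n = Σ (List Step) λ p → IsPath 𝒮 p × xEnd p ≡ n × yEnd p ≡ - m

P : StepSet → ℤ → ℕ → Set
P 𝒮 m n = Σ (List Step) λ p → (IsPath 𝒮 p × xEnd p ≡ n × yEnd p ≡ - m) × Above 0ℤ p

-- occurrences of step s over all paths of P_𝒮(m,n):
-- pairs (path, position i) with the i-th step equal to s
Occ : StepSet → ℤ → ℕ → Step → Set
Occ 𝒮 m n s = Σ (P 𝒮 m n) λ q → Σ (Fin (length (Σ.proj₁ q))) λ i → lookup (Σ.proj₁ q) i ≡ s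

SameCard : Set → Set → Set
SameCard A B = ∃ λ c → (A ↔ Fin c) × (B ↔ Fin c)

-- Cycle lemma.  Every path q factors uniquely as q = B ++ A where B ends at a
-- strict minimum of q and A starts at a (weak) minimum of q: cut q at the last
-- point where its minimum height is reached.  An occurrence of a step s in a
-- path A ++ s ∷ B of P(1,n) is exactly such a factorisation of the rotated path
-- B ++ A, which ends at (n - dx s, -1 - dy s).  Hence the occurrences of s are
-- in bijection with F(1 + dy s, n - dx s).  The upper bound N on the steps only
-- serves to make these sets finite: coding V as 0 and S k as 1 + (N - k) maps a
-- path of F(m,n) injectively to a composition of (N + 2) n + m.
module Submission where

open import Defs
open import Data.Nat using (ℕ; _∸_; zero; suc)
open import Data.Integer using (ℤ; +_; _+_; _≤_; 0ℤ; 1ℤ)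
open import Data.Bool using (T)
open import Data.Product using (_×_)

import Data.Nat as ℕ
import Data.Nat.Properties as ℕ
open import Data.Nat.Induction using (<-rec)
open import Data.Integer using (-_; _-_; _*_; ∣_∣; -1ℤ; -[1+_]; +≤+; +<+; _<_)
import Data.Integer.Properties as ℤ
open import Data.Integer.Tactic.RingSolver using (solve-∀)
open import Data.Nat.Tactic.RingSolver renaming (solve-∀ to ℕ-solve-∀)
open import Data.Bool using (true; false)
open import Data.Bool.Properties using (T-irrelevant)
open import Data.List using (List; []; _∷_; _++_; length; lookup; map)
open import Data.Nat.ListAction using (sum)
import Data.List.Properties as List
open import Data.List.Relation.Unary.All as All using (All; []; _∷_)
import Data.List.Relation.Unary.All.Properties as All
open import Data.Fin using (Fin; zero; suc; toℕ; fromℕ<)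
import Data.Fin.Properties as Fin
open import Data.Product using (Σ; _,_; proj₁; proj₂; uncurry; map₁)
open import Data.Product.Function.Dependent.Propositional using (Σ-↔)
open import Data.Sum using (_⊎_; inj₁; inj₂)
open import Data.Sum.Function.Propositional using (_⊎-↔_)
open import Data.Unit using (⊤; tt)
open import Data.Empty using (⊥-elim)
open import Function using (_∘_)
open import Function.Bundles using (_↔_; mk↔ₛ′; Inverse)
open import Function.Properties.Inverse using (↔-refl; ↔-sym; ↔-trans)
open import Function.Related.TypeIsomorphisms using (Σ-assoc; ×-comm)
open import Relation.Nullary using (Dec; yes; no; ¬_; Irrelevant)
open import Relation.Nullary.Decidable using (True-↔; _×-dec_)
open import Relation.Nullary.Decidable.Core using (T?)
open import Relation.Binary.PropositionalEquality
open import Axiom.UniquenessOfIdentityProofs using (module Decidable⇒UIP)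

×-irrelevant : {A B : Set} → Irrelevant A → Irrelevant B → Irrelevant (A × B)
×-irrelevant irrA irrB (a , b) (a′ , b′) = cong₂ _,_ (irrA a a′) (irrB b b′)

ℤ-≡-irrelevant : {i j : ℤ} → Irrelevant (i ≡ j)
ℤ-≡-irrelevant = Decidable⇒UIP.≡-irrelevant ℤ._≟_

Σ-≡-irrelevant : {A : Set} {B : A → Set} → (∀ a → Irrelevant (B a)) →
                 {x y : Σ A B} → proj₁ x ≡ proj₁ y → x ≡ y
Σ-≡-irrelevant irr {a , b} {.a , b′} refl = cong (a ,_) (irr a b b′)

irrelevant-↔ : {A B : Set} → Irrelevant A → Irrelevant B → (A → B) → (B → A) → A ↔ B
irrelevant-↔ irrA irrB f g = mk↔ₛ′ f g (λ _ → irrB _ _) (λ _ → irrA _ _)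

Finite : Set → Set
Finite A = Σ ℕ λ c → A ↔ Fin c

Finite-↔ : {A B : Set} → A ↔ B → Finite A → Finite B
Finite-↔ A↔B (c , A↔Fin) = c , ↔-trans (↔-sym A↔B) A↔Fin

Finite-T : ∀ b → Finite (T b)
Finite-T true  = 1 , ↔-sym Fin.1↔⊤
Finite-T false = 0 , ↔-sym Fin.0↔⊥

Finite-Dec : {A : Set} → Dec A → Irrelevant A → Finite A
Finite-Dec a? irr = Finite-↔ (True-↔ a? irr) (Finite-T _)

Finite-⊎ : {A B : Set} → Finite A → Finite B → Finite (A ⊎ B)
Finite-⊎ (a , A↔Fin) (b , B↔Fin) = a ℕ.+ b , ↔-trans (A↔Fin ⊎-↔ B↔Fin) (↔-sym Fin.+↔⊎)

Σ-Fin-suc-↔ : {c : ℕ} {B : Fin (suc c) → Set} → Σ (Fin (suc c)) B ↔ (B zero ⊎ Σ (Fin c) (B ∘ suc))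
Σ-Fin-suc-↔ = mk↔ₛ′
  (λ { (zero , b) → inj₁ b ; (suc i , b) → inj₂ (i , b) })
  (λ { (inj₁ b) → zero , b ; (inj₂ (i , b)) → suc i , b })
  (λ { (inj₁ _) → refl ; (inj₂ _) → refl })
  (λ { (zero , _) → refl ; (suc _ , _) → refl })

Finite-ΣFin : ∀ c {B : Fin c → Set} → (∀ i → Finite (B i)) → Finite (Σ (Fin c) B)
Finite-ΣFin zero    _   = 0 , mk↔ₛ′ (λ ()) (λ ()) (λ ()) (λ ())
Finite-ΣFin (suc c) fin = Finite-↔ (↔-sym Σ-Fin-suc-↔) (Finite-⊎ (fin zero) (Finite-ΣFin c (fin ∘ suc)))

Finite-Σ : {A : Set} {B : A → Set} → Finite A → (∀ a → Finite (B a)) → Finite (Σ A B)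
Finite-Σ (c , A↔Fin) fin =
  Finite-↔ (Σ-↔ (↔-sym A↔Fin) ↔-refl) (Finite-ΣFin c (fin ∘ Inverse.from A↔Fin))

Composition : ℕ → Set
Composition w = Σ (List ℕ) λ cs → sum (map suc cs) ≡ w

Composition-zero-↔ : Composition 0 ↔ ⊤
Composition-zero-↔ = mk↔ₛ′ _ (λ _ → [] , refl) (λ _ → refl)
  λ { ([] , refl) → refl ; (_ ∷ _ , ()) }

Composition-suc-↔ : ∀ w → Composition (suc w) ↔ Σ (Fin (suc w)) (λ j → Composition (w ∸ toℕ j))
Composition-suc-↔ w = mk↔ₛ′ to from to∘from from∘to
  where
  first<1+w : ∀ c cs → suc c ℕ.+ sum (map suc cs) ≡ suc w → c ℕ.< suc w
  first<1+w c cs refl = ℕ.s≤s (ℕ.m≤m+n c _)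

  rest : ∀ c cs (eq : suc c ℕ.+ sum (map suc cs) ≡ suc w) →
         sum (map suc cs) ≡ w ∸ toℕ (fromℕ< (first<1+w c cs eq))
  rest c cs eq rewrite Fin.toℕ-fromℕ< (first<1+w c cs eq) =
    trans (sym (ℕ.m+n∸m≡n c _)) (cong (_∸ c) (ℕ.suc-injective eq))

  to : Composition (suc w) → Σ (Fin (suc w)) (λ j → Composition (w ∸ toℕ j))
  to (c ∷ cs , eq) = fromℕ< (first<1+w c cs eq) , cs , rest c cs eq

  from : Σ (Fin (suc w)) (λ j → Composition (w ∸ toℕ j)) → Composition (suc w)
  from (j , cs , eq) =
    toℕ j ∷ cs , cong suc (trans (cong (toℕ j ℕ.+_) eq) (ℕ.m+[n∸m]≡n (Fin.toℕ≤pred[n] j)))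

  to∘from : ∀ y → to (from y) ≡ y
  to∘from (j , cs , eq) = cong-Σ (Fin.fromℕ<-toℕ j _) _ eq
    where
    cong-Σ : ∀ {i j cs} → i ≡ j → (p : sum (map suc cs) ≡ w ∸ toℕ i) (q : sum (map suc cs) ≡ w ∸ toℕ j) →
             _≡_ {A = Σ (Fin (suc w)) (λ j → Composition (w ∸ toℕ j))} (i , cs , p) (j , cs , q)
    cong-Σ refl p q = cong (λ r → _ , _ , r) (ℕ.≡-irrelevant p q)

  from∘to : ∀ x → from (to x) ≡ x
  from∘to (c ∷ cs , eq) = Σ-≡-irrelevant (λ _ → ℕ.≡-irrelevant) (cong (_∷ cs) (Fin.toℕ-fromℕ< _))

Finite-Composition : ∀ w → Finite (Composition w)
Finite-Composition = <-rec (Finite ∘ Composition) finite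
  where
  finite : ∀ w → (∀ {v} → v ℕ.< w → Finite (Composition v)) → Finite (Composition w)
  finite zero    _   = Finite-↔ (↔-sym Composition-zero-↔) (Finite-T true)
  finite (suc w) rec = Finite-↔ (↔-sym (Composition-suc-↔ w))
    (Finite-ΣFin (suc w) λ j → rec (ℕ.s≤s (ℕ.m∸n≤m w (toℕ j))))

xEnd-++ : ∀ p q → xEnd (p ++ q) ≡ xEnd p ℕ.+ xEnd q
xEnd-++ []      q = refl
xEnd-++ (s ∷ p) q = trans (cong (dx s ℕ.+_) (xEnd-++ p q)) (sym (ℕ.+-assoc (dx s) (xEnd p) (xEnd q)))

yEnd-++ : ∀ p q → yEnd (p ++ q) ≡ yEnd p + yEnd q
yEnd-++ []      q = sym (ℤ.+-identityˡ (yEnd q))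
yEnd-++ (s ∷ p) q = trans (cong (λ y → dy s + y) (yEnd-++ p q)) (sym (ℤ.+-assoc (dy s) (yEnd p) (yEnd q)))

IsPath-irrelevant : ∀ 𝒮 p → Irrelevant (IsPath 𝒮 p)
IsPath-irrelevant 𝒮 p = All.irrelevant T-irrelevant

Above-irrelevant : ∀ h p → Irrelevant (Above h p)
Above-irrelevant h []      tt tt = refl
Above-irrelevant h (s ∷ p) = ×-irrelevant ℤ.≤-irrelevant (Above-irrelevant (h + dy s) p)

Above-mono : ∀ {h h′} p → h ≤ h′ → Above h p → Above h′ p
Above-mono []      _    _         = tt
Above-mono (s ∷ p) h≤h′ (0≤h , a) = ℤ.≤-trans 0≤h h≤h′ , Above-mono p (ℤ.+-monoˡ-≤ (dy s) h≤h′) a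

Above-++⁻ : ∀ h p q → Above h (p ++ q) → Above h p × Above (h + yEnd p) q
Above-++⁻ h []      q a = tt , subst (λ h′ → Above h′ q) (sym (ℤ.+-identityʳ h)) a
Above-++⁻ h (s ∷ p) q (0≤h , a) with Above-++⁻ (h + dy s) p q a
... | ap , aq = (0≤h , ap) , subst (λ h′ → Above h′ q) (ℤ.+-assoc h (dy s) (yEnd p)) aq

Above-++⁺ : ∀ h p q → Above h p → Above (h + yEnd p) q → Above h (p ++ q)
Above-++⁺ h []      q _         aq = subst (λ h′ → Above h′ q) (ℤ.+-identityʳ h) aq
Above-++⁺ h (s ∷ p) q (0≤h , ap) aq =
  0≤h , Above-++⁺ (h + dy s) p q ap (subst (λ h′ → Above h′ q) (sym (ℤ.+-assoc h (dy s) (yEnd p))) aq)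

0≤+ : ∀ {i j} → 0ℤ ≤ i → 0ℤ ≤ j → 0ℤ ≤ i + j
0≤+ = ℤ.+-mono-≤

≤-+-nonneg : ∀ i {j} → 0ℤ ≤ j → i ≤ i + j
≤-+-nonneg i 0≤j = subst (_≤ i + _) (ℤ.+-identityʳ i) (ℤ.+-monoʳ-≤ i 0≤j)

0≤-1-neg : ∀ {i} → i < 0ℤ → 0ℤ ≤ -1ℤ - i
0≤-1-neg { -[1+ _ ]} _          = +≤+ ℕ.z≤n
0≤-1-neg {+ _}      (+<+ ())

-- Started at the height that puts its endpoint at -1, B stays ≥ 0 before the end.
EndsAtStrictMinimum : List Step → Set
EndsAtStrictMinimum B = Above (-1ℤ - yEnd B) B

StartsAtMinimum : List Step → Set
StartsAtMinimum A = Above 0ℤ A × 0ℤ ≤ 0ℤ + yEnd A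

SplitAtLastMinimum : List Step × List Step → Set
SplitAtLastMinimum (B , A) = EndsAtStrictMinimum B × StartsAtMinimum A

SplitAtLastMinimum-irrelevant : ∀ BA → Irrelevant (SplitAtLastMinimum BA)
SplitAtLastMinimum-irrelevant (B , A) =
  ×-irrelevant (Above-irrelevant _ B) (×-irrelevant (Above-irrelevant 0ℤ A) ℤ.≤-irrelevant)

height-after-first : ∀ d y → -1ℤ - (d + y) + d ≡ -1ℤ - y
height-after-first = solve-∀

EndsAtStrictMinimum-∷⁻ : ∀ {s B} → EndsAtStrictMinimum (s ∷ B) → EndsAtStrictMinimum B
EndsAtStrictMinimum-∷⁻ {s} {B} (_ , a) = subst (λ h → Above h B) (height-after-first (dy s) (yEnd B)) a

EndsAtStrictMinimum-∷⁺ : ∀ {s B} → dy s + yEnd B < 0ℤ → EndsAtStrictMinimum B → EndsAtStrictMinimum (s ∷ B)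
EndsAtStrictMinimum-∷⁺ {s} {B} y<0 a =
  0≤-1-neg y<0 , subst (λ h → Above h B) (sym (height-after-first (dy s) (yEnd B))) a

StartsAtMinimum-∷ : ∀ {s B A} → 0ℤ ≤ dy s + yEnd B → EndsAtStrictMinimum B → StartsAtMinimum A →
                    StartsAtMinimum (s ∷ B ++ A)
StartsAtMinimum-∷ {s} {B} {A} 0≤y B↓ (aA , 0≤yA) =
  (ℤ.≤-refl , Above-++⁺ (0ℤ + dy s) B A aB aA′) , subst (0ℤ ≤_) end-height (0≤+ 0≤y 0≤yA)
  where
  d = dy s
  y = yEnd B

  aB : Above (0ℤ + d) B
  aB = Above-mono B (subst (-1ℤ - y ≤_) (lemma d y) (≤-+-nonneg (-1ℤ - y) (0≤+ (+≤+ ℕ.z≤n) 0≤y))) B↓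
    where
    lemma : ∀ d y → -1ℤ - y + (1ℤ + (d + y)) ≡ 0ℤ + d
    lemma = solve-∀

  aA′ : Above (0ℤ + d + y) A
  aA′ = Above-mono A (subst (0ℤ ≤_) (lemma d y) 0≤y) aA
    where
    lemma : ∀ d y → d + y ≡ 0ℤ + d + y
    lemma = solve-∀

  end-height : d + y + (0ℤ + yEnd A) ≡ 0ℤ + (d + yEnd (B ++ A))
  end-height = trans (lemma d y (yEnd A)) (cong (λ z → 0ℤ + (d + z)) (sym (yEnd-++ B A)))
    where
    lemma : ∀ d y a → d + y + (0ℤ + a) ≡ 0ℤ + (d + (y + a))
    lemma = solve-∀

split-at-last-minimum : ∀ q → Σ (List Step × List Step) λ BA → SplitAtLastMinimum BA × uncurry _++_ BA ≡ q
split-at-last-minimum [] = ([] , []) , (tt , tt , ℤ.≤-refl) , refl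
split-at-last-minimum (s ∷ q) with split-at-last-minimum q
... | (B , A) , (B↓ , A↑) , refl with 0ℤ ℤ.≤? dy s + yEnd B
...   | yes 0≤y = ([] , s ∷ B ++ A) , (tt , StartsAtMinimum-∷ {s} 0≤y B↓ A↑) , refl
...   | no  0≰y = (s ∷ B , A) , (EndsAtStrictMinimum-∷⁺ {s} (ℤ.≰⇒> 0≰y) B↓ , A↑) , refl

StartsAtMinimum-++⁻ : ∀ p q → StartsAtMinimum (p ++ q) → 0ℤ ≤ 0ℤ + yEnd p
StartsAtMinimum-++⁻ p []      (a , 0≤y) = subst (λ r → 0ℤ ≤ 0ℤ + yEnd r) (List.++-identityʳ p) 0≤y
StartsAtMinimum-++⁻ p (s ∷ q) (a , _)   = proj₁ (proj₂ (Above-++⁻ 0ℤ p (s ∷ q) a))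

-- A nonempty path ending at a strict minimum ends strictly below its start.
EndsAtStrictMinimum⇒¬StartsAtMinimum : ∀ {s B} A → EndsAtStrictMinimum (s ∷ B) → ¬ StartsAtMinimum (s ∷ B ++ A)
EndsAtStrictMinimum⇒¬StartsAtMinimum {s} {B} A (0≤h , _) A↑ =
  0≰-1 (subst (0ℤ ≤_) (lemma (yEnd (s ∷ B))) (0≤+ 0≤h (StartsAtMinimum-++⁻ (s ∷ B) A A↑)))
  where
  lemma : ∀ y → -1ℤ - y + (0ℤ + y) ≡ -1ℤ
  lemma = solve-∀
  0≰-1 : ¬ (0ℤ ≤ -1ℤ)
  0≰-1 ()

SplitAtLastMinimum-unique : ∀ {B A B′ A′} → B ++ A ≡ B′ ++ A′ →
  SplitAtLastMinimum (B , A) → SplitAtLastMinimum (B′ , A′) → (B , A) ≡ (B′ , A′)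
SplitAtLastMinimum-unique {[]}    {_} {[]}     eq _ _ = cong ([] ,_) eq
SplitAtLastMinimum-unique {[]}    {_} {s ∷ _} {A′} refl (_ , A↑) (B′↓ , _) =
  ⊥-elim (EndsAtStrictMinimum⇒¬StartsAtMinimum {s} A′ B′↓ A↑)
SplitAtLastMinimum-unique {s ∷ _} {A} {[]}     refl (B↓ , _) (_ , A′↑) =
  ⊥-elim (EndsAtStrictMinimum⇒¬StartsAtMinimum {s} A B↓ A′↑)
SplitAtLastMinimum-unique {s ∷ _} {_} {_ ∷ _} eq (B↓ , A↑) (B′↓ , A′↑) with List.∷-injective eq
... | refl , eq′ = cong (map₁ (s ∷_))
  (SplitAtLastMinimum-unique eq′ (EndsAtStrictMinimum-∷⁻ {s} B↓ , A↑) (EndsAtStrictMinimum-∷⁻ {s} B′↓ , A′↑))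

last-minimum-↔ : Σ (List Step × List Step) SplitAtLastMinimum ↔ List Step
last-minimum-↔ = mk↔ₛ′ (uncurry _++_ ∘ proj₁) split ++-split split-++
  where
  split : List Step → Σ (List Step × List Step) SplitAtLastMinimum
  split q = let (BA , BA-split , _) = split-at-last-minimum q in BA , BA-split

  ++-split : ∀ q → uncurry _++_ (proj₁ (split q)) ≡ q
  ++-split q = proj₂ (proj₂ (split-at-last-minimum q))

  split-++ : ∀ x → split (uncurry _++_ (proj₁ x)) ≡ x
  split-++ ((B , A) , BA-split) =
    let (_ , BA′-split , eq) = split-at-last-minimum (B ++ A)
    in Σ-≡-irrelevant SplitAtLastMinimum-irrelevant (SplitAtLastMinimum-unique eq BA′-split BA-split)

module _ {A : Set} (x : A) where

  Position : List A → Set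
  Position xs = Σ (Fin (length xs)) λ i → lookup xs i ≡ x

  position-++ : ∀ ys zs → Position (ys ++ x ∷ zs)
  position-++ []       zs = zero , refl
  position-++ (_ ∷ ys) zs = let (i , eq) = position-++ ys zs in suc i , eq

  split-at : ∀ xs → Position xs → List A × List A
  split-at (_ ∷ xs) (zero  , _)  = [] , xs
  split-at (y ∷ xs) (suc i , eq) = map₁ (y ∷_) (split-at xs (i , eq))

  split-at-↔ : (List A × List A) ↔ Σ (List A) Position
  split-at-↔ = mk↔ₛ′ (λ (ys , zs) → ys ++ x ∷ zs , position-++ ys zs) (uncurry split-at) rejoin resplit
    where
    rejoin : ∀ xp → let (ys , zs) = uncurry split-at xp in (ys ++ x ∷ zs , position-++ ys zs) ≡ xp
    rejoin (_ ∷ xs , zero  , refl) = refl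
    rejoin (y ∷ xs , suc i , eq)   = cong (λ (xs′ , i′ , eq′) → y ∷ xs′ , suc i′ , eq′) (rejoin (xs , i , eq))

    resplit : ∀ yz → let (ys , zs) = yz in split-at (ys ++ x ∷ zs) (position-++ ys zs) ≡ yz
    resplit ([]     , zs) = refl
    resplit (y ∷ ys , zs) = cong (map₁ (y ∷_)) (resplit (ys , zs))

  Σ-Position-↔ : (X : List A → Set) →
                 Σ (Σ (List A) X) (Position ∘ proj₁) ↔ Σ (List A × List A) (λ (ys , zs) → X (ys ++ x ∷ zs))
  Σ-Position-↔ X = ↔-trans swap-↔ (↔-sym (Σ-↔ split-at-↔ ↔-refl))
    where
    swap-↔ : Σ (Σ (List A) X) (Position ∘ proj₁) ↔ Σ (Σ (List A) Position) (X ∘ proj₁)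
    swap-↔ = mk↔ₛ′ (λ ((xs , χ) , pos) → (xs , pos) , χ) (λ ((xs , pos) , χ) → (xs , χ) , pos)
                   (λ _ → refl) (λ _ → refl)

InF : StepSet → ℤ → ℕ → List Step → Set
InF 𝒮 m n p = IsPath 𝒮 p × xEnd p ≡ n × yEnd p ≡ - m

InF-irrelevant : ∀ 𝒮 m n p → Irrelevant (InF 𝒮 m n p)
InF-irrelevant 𝒮 m n p = ×-irrelevant (IsPath-irrelevant 𝒮 p) (×-irrelevant ℕ.≡-irrelevant ℤ-≡-irrelevant)

module _ (s : Step) (A B : List Step) where

  xEnd-rotate : xEnd (A ++ s ∷ B) ≡ dx s ℕ.+ xEnd (B ++ A)
  xEnd-rotate = begin
    xEnd (A ++ s ∷ B)              ≡⟨ xEnd-++ A (s ∷ B) ⟩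
    xEnd A ℕ.+ (dx s ℕ.+ xEnd B)   ≡⟨ lemma (xEnd A) (dx s) (xEnd B) ⟩
    dx s ℕ.+ (xEnd B ℕ.+ xEnd A)   ≡⟨ cong (dx s ℕ.+_) (xEnd-++ B A) ⟨
    dx s ℕ.+ xEnd (B ++ A)         ∎
    where
    open ≡-Reasoning
    lemma : ∀ a d b → a ℕ.+ (d ℕ.+ b) ≡ d ℕ.+ (b ℕ.+ a)
    lemma = ℕ-solve-∀

  yEnd-rotate : yEnd (A ++ s ∷ B) ≡ dy s + yEnd (B ++ A)
  yEnd-rotate = begin
    yEnd (A ++ s ∷ B)          ≡⟨ yEnd-++ A (s ∷ B) ⟩
    yEnd A + (dy s + yEnd B)   ≡⟨ lemma (yEnd A) (dy s) (yEnd B) ⟩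
    dy s + (yEnd B + yEnd A)   ≡⟨ cong (λ y → dy s + y) (yEnd-++ B A) ⟨
    dy s + yEnd (B ++ A)       ∎
    where
    open ≡-Reasoning
    lemma : ∀ a d b → a + (d + b) ≡ d + (b + a)
    lemma = solve-∀

  IsPath-rotate⁻ : ∀ {𝒮} → IsPath 𝒮 (A ++ s ∷ B) → IsPath 𝒮 (B ++ A)
  IsPath-rotate⁻ path with All.++⁻ A path
  ... | pathA , _ ∷ pathB = All.++⁺ pathB pathA

  IsPath-rotate⁺ : ∀ {𝒮} → T (𝒮 s) → IsPath 𝒮 (B ++ A) → IsPath 𝒮 (A ++ s ∷ B)
  IsPath-rotate⁺ s∈𝒮 path with All.++⁻ B path
  ... | pathB , pathA = All.++⁺ pathA (s∈𝒮 ∷ pathB)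

  height-before-B : yEnd (A ++ s ∷ B) ≡ -1ℤ → 0ℤ + yEnd A + dy s ≡ -1ℤ - yEnd B
  height-before-B y≡-1 = begin
    0ℤ + yEnd A + dy s                ≡⟨ lemma (yEnd A) (dy s) (yEnd B) ⟩
    yEnd A + (dy s + yEnd B) - yEnd B ≡⟨ cong (_- yEnd B) (yEnd-++ A (s ∷ B)) ⟨
    yEnd (A ++ s ∷ B) - yEnd B        ≡⟨ cong (_- yEnd B) y≡-1 ⟩
    -1ℤ - yEnd B                      ∎
    where
    open ≡-Reasoning
    lemma : ∀ a d b → 0ℤ + a + d ≡ a + (d + b) - b
    lemma = solve-∀

  Above-rotate⁻ : yEnd (A ++ s ∷ B) ≡ -1ℤ → Above 0ℤ (A ++ s ∷ B) → SplitAtLastMinimum (B , A)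
  Above-rotate⁻ y≡-1 above with Above-++⁻ 0ℤ A (s ∷ B) above
  ... | aboveA , 0≤yA , aboveB = subst (λ h → Above h B) (height-before-B y≡-1) aboveB , aboveA , 0≤yA

  Above-rotate⁺ : yEnd (A ++ s ∷ B) ≡ -1ℤ → SplitAtLastMinimum (B , A) → Above 0ℤ (A ++ s ∷ B)
  Above-rotate⁺ y≡-1 (B↓ , aboveA , 0≤yA) =
    Above-++⁺ 0ℤ A (s ∷ B) aboveA (0≤yA , subst (λ h → Above h B) (sym (height-before-B y≡-1)) B↓)

  rotate-↔ : ∀ {𝒮 n} → T (𝒮 s) → dx s ℕ.≤ n →
             (InF 𝒮 1ℤ n (A ++ s ∷ B) × Above 0ℤ (A ++ s ∷ B)) ↔
             (SplitAtLastMinimum (B , A) × InF 𝒮 (1ℤ + dy s) (n ∸ dx s) (B ++ A))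
  rotate-↔ {𝒮} {n} s∈𝒮 dx≤n = irrelevant-↔
    (×-irrelevant (InF-irrelevant 𝒮 1ℤ n _) (Above-irrelevant 0ℤ _))
    (×-irrelevant (SplitAtLastMinimum-irrelevant (B , A)) (InF-irrelevant 𝒮 _ _ _))
    (λ ((path , x≡n , y≡-1) , above) →
       Above-rotate⁻ y≡-1 above , IsPath-rotate⁻ path , x-to x≡n , y-to y≡-1)
    (λ (split , path , x≡ , y≡) →
       (IsPath-rotate⁺ s∈𝒮 path , x-from x≡ , y-from y≡) , Above-rotate⁺ (y-from y≡) split)
    where
    x-to : xEnd (A ++ s ∷ B) ≡ n → xEnd (B ++ A) ≡ n ∸ dx s
    x-to x≡n = trans (sym (ℕ.m+n∸m≡n (dx s) _)) (cong (_∸ dx s) (trans (sym xEnd-rotate) x≡n))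

    x-from : xEnd (B ++ A) ≡ n ∸ dx s → xEnd (A ++ s ∷ B) ≡ n
    x-from x≡ = trans xEnd-rotate (trans (cong (dx s ℕ.+_) x≡) (ℕ.m+[n∸m]≡n dx≤n))

    y-to : yEnd (A ++ s ∷ B) ≡ - 1ℤ → yEnd (B ++ A) ≡ - (1ℤ + dy s)
    y-to y≡-1 = begin
      yEnd (B ++ A)                ≡⟨ lemma₁ (dy s) (yEnd (B ++ A)) ⟩
      dy s + yEnd (B ++ A) - dy s  ≡⟨ cong (_- dy s) (trans (sym yEnd-rotate) y≡-1) ⟩
      - 1ℤ - dy s                  ≡⟨ lemma₂ (dy s) ⟩
      - (1ℤ + dy s)                ∎
      where
      open ≡-Reasoning
      lemma₁ : ∀ d y → y ≡ d + y - d
      lemma₁ = solve-∀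
      lemma₂ : ∀ d → - 1ℤ - d ≡ - (1ℤ + d)
      lemma₂ = solve-∀

    y-from : yEnd (B ++ A) ≡ - (1ℤ + dy s) → yEnd (A ++ s ∷ B) ≡ - 1ℤ
    y-from y≡ = trans yEnd-rotate (trans (cong (λ y → dy s + y) y≡) (lemma (dy s)))
      where
      lemma : ∀ d → d + - (1ℤ + d) ≡ - 1ℤ
      lemma = solve-∀

occurrences-↔ : ∀ {𝒮 n s} → T (𝒮 s) → dx s ℕ.≤ n → Occ 𝒮 1ℤ n s ↔ F 𝒮 (1ℤ + dy s) (n ∸ dx s)
occurrences-↔ {𝒮} {n} {s} s∈𝒮 dx≤n =
  ↔-trans (Σ-Position-↔ s (λ p → InF 𝒮 1ℤ n p × Above 0ℤ p))
    (↔-trans (Σ-↔ (×-comm _ _) (λ {(A , B)} → rotate-↔ s A B s∈𝒮 dx≤n))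
      (↔-trans (↔-sym Σ-assoc)
        (Σ-↔ last-minimum-↔ ↔-refl)))

InF? : ∀ 𝒮 m n p → Dec (InF 𝒮 m n p)
InF? 𝒮 m n p = All.all? (T? ∘ 𝒮) p ×-dec (xEnd p ℕ.≟ n ×-dec yEnd p ℤ.≟ - m)

module Coding (N : ℕ) where

  Bounded : Step → Set
  Bounded V     = ⊤
  Bounded (S k) = k ≤ + N

  code : Step → ℕ
  code V     = 0
  code (S k) = suc ∣ + N - k ∣

  decode : ℕ → Step
  decode zero    = V
  decode (suc j) = S (+ N - + j)

  decode-code : ∀ s → Bounded s → decode (code s) ≡ s
  decode-code V     _   = refl
  decode-code (S k) k≤N =
    cong S (trans (cong (λ i → + N - i) (ℤ.0≤i⇒+∣i∣≡i (ℤ.i≤j⇒0≤j-i k≤N))) (lemma (+ N) k))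
    where
    lemma : ∀ n k → n - (n - k) ≡ k
    lemma = solve-∀

  code-decode : ∀ c → code (decode c) ≡ c
  code-decode zero    = refl
  code-decode (suc j) = cong (suc ∘ ∣_∣) (lemma (+ N) (+ j))
    where
    lemma : ∀ n j → n - (n - j) ≡ j
    lemma = solve-∀

  map-decode-code : ∀ {p} → All Bounded p → map decode (map code p) ≡ p
  map-decode-code {p} bounded =
    trans (sym (List.map-∘ p)) (List.map-id-local (All.map (λ {s} → decode-code s) bounded))

  map-code-decode : ∀ cs → map code (map decode cs) ≡ cs
  map-code-decode cs = trans (sym (List.map-∘ cs)) (List.map-id-local (All.universal code-decode cs))

  M : ℤ
  M = + (2 ℕ.+ N)

  weight-code : ∀ s → Bounded s → + suc (code s) ≡ + dx s * M - dy s
  weight-code V     _   = refl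
  weight-code (S k) k≤N = begin
    + suc (suc ∣ + N - k ∣) ≡⟨ ℤ.pos-+ 2 ∣ + N - k ∣ ⟩
    + 2 + + ∣ + N - k ∣    ≡⟨ cong (λ i → + 2 + i) (ℤ.0≤i⇒+∣i∣≡i (ℤ.i≤j⇒0≤j-i k≤N)) ⟩
    + 2 + (+ N - k)        ≡⟨ lemma (+ N) k ⟩
    + 1 * (+ 2 + + N) - k  ∎
    where
    open ≡-Reasoning
    lemma : ∀ n k → + 2 + (n - k) ≡ + 1 * (+ 2 + n) - k
    lemma = solve-∀

  weight-map-code : ∀ p → All Bounded p → + sum (map suc (map code p)) ≡ + xEnd p * M - yEnd p
  weight-map-code []      []                 = refl
  weight-map-code (s ∷ p) (bounded ∷ boundeds) = begin
    + (suc (code s) ℕ.+ sum (map suc (map code p)))      ≡⟨ ℤ.pos-+ (suc (code s)) _ ⟩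
    + suc (code s) + + sum (map suc (map code p))        ≡⟨ cong₂ _+_ (weight-code s bounded) (weight-map-code p boundeds) ⟩
    (+ dx s * M - dy s) + (+ xEnd p * M - yEnd p)        ≡⟨ lemma (+ dx s) (+ xEnd p) (dy s) (yEnd p) M ⟩
    (+ dx s + + xEnd p) * M - (dy s + yEnd p)            ≡⟨ cong (λ x → x * M - (dy s + yEnd p)) (ℤ.pos-+ (dx s) (xEnd p)) ⟨
    + (dx s ℕ.+ xEnd p) * M - (dy s + yEnd p)            ∎
    where
    open ≡-Reasoning
    lemma : ∀ a b c d m → (a * m - c) + (b * m - d) ≡ (a + b) * m - (c + d)
    lemma = solve-∀

  Σ-map-decode-↔ : ∀ 𝒮 → (∀ k → T (𝒮 (S k)) → k ≤ + N) → ∀ m n →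
    F 𝒮 m n ↔ Σ (Composition ∣ + n * M - - m ∣) (InF 𝒮 m n ∘ map decode ∘ proj₁)
  Σ-map-decode-↔ 𝒮 𝒮-bounded m n = mk↔ₛ′ to from to∘from from∘to
    where
    bounded : ∀ {p} → IsPath 𝒮 p → All Bounded p
    bounded = All.map λ { {V} _ → tt ; {S k} k∈𝒮 → 𝒮-bounded k k∈𝒮 }

    to : F 𝒮 m n → Σ (Composition ∣ + n * M - - m ∣) (InF 𝒮 m n ∘ map decode ∘ proj₁)
    to (p , inF@(path , x≡n , y≡-m)) =
      (map code p , cong ∣_∣ (trans (weight-map-code p (bounded path)) (cong₂ (λ x y → + x * M - y) x≡n y≡-m))) ,
      subst (InF 𝒮 m n) (sym (map-decode-code (bounded path))) inF

    from : Σ (Composition ∣ + n * M - - m ∣) (InF 𝒮 m n ∘ map decode ∘ proj₁) → F 𝒮 m n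
    from ((cs , _) , inF) = map decode cs , inF

    to∘from : ∀ y → to (from y) ≡ y
    to∘from ((cs , _) , _) = Σ-≡-irrelevant (λ c → InF-irrelevant 𝒮 m n (map decode (proj₁ c)))
      (Σ-≡-irrelevant (λ _ → ℕ.≡-irrelevant) (map-code-decode cs))

    from∘to : ∀ x → from (to x) ≡ x
    from∘to (_ , path , _) = Σ-≡-irrelevant (InF-irrelevant 𝒮 m n) (map-decode-code (bounded path))

Finite-F : ∀ N 𝒮 → (∀ k → T (𝒮 (S k)) → k ≤ + N) → ∀ m n → Finite (F 𝒮 m n)
Finite-F N 𝒮 𝒮-bounded m n = Finite-↔ (↔-sym (Σ-map-decode-↔ 𝒮 𝒮-bounded m n))
  (Finite-Σ (Finite-Composition _) λ (cs , _) →
     Finite-Dec (InF? 𝒮 m n (map decode cs)) (InF-irrelevant 𝒮 m n (map decode cs)))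
  where open Coding N

sameCard : {A B : Set} → A ↔ B → Finite B → SameCard A B
sameCard A↔B (c , B↔Fin) = c , ↔-trans A↔B B↔Fin , B↔Fin

mainTheorem4 : (N : ℕ) (𝒮 : StepSet)
    → (∀ k → T (𝒮 (S k)) → k ≤ + N)
    → T (𝒮 (S (+ N)))
    → (n : ℕ) → 1 Data.Nat.≤ n
    → (T (𝒮 V) → SameCard (Occ 𝒮 1ℤ n V) (F 𝒮 0ℤ n))
      × (∀ k → T (𝒮 (S k)) → SameCard (Occ 𝒮 1ℤ n (S k)) (F 𝒮 (1ℤ + k) (n ∸ 1)))
mainTheorem4 N 𝒮 𝒮-bounded _ n 1≤n =
  (λ V∈𝒮 → sameCard (occurrences-↔ V∈𝒮 ℕ.z≤n) (Finite-F N 𝒮 𝒮-bounded 0ℤ n)) ,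
  (λ k Sk∈𝒮 → sameCard (occurrences-↔ Sk∈𝒮 1≤n) (Finite-F N 𝒮 𝒮-bounded (1ℤ + k) (n ∸ 1)))
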